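{- Let $(X,\le)$ be a poset, $E$ an equivalence relation on $X$ with ${\le}\subseteq E$, and $\alpha\colon X\to X$ an order automorphism of $(X,\le)$ with $\alpha\subseteq E$. (i) With $0=\alpha\circ(\le^{c})^{\smile}$ (which equals $(\le^{c})^{\smile}\circ\alpha$), the algebra $\langle\mathsf{Up}(\mathbf E),\cap,\cup,\circ,{\le},0,{\sim},{ - }\rangle$ is a distributive involutive FL-algebra, where ${\sim}R=R\backslash 0=(R^{\smile}\circ 0^{c})^{c}$ and ${ - }R=0/R=(0^{c}\circ R^{\smile})^{c}$. (ii) For every positive integer $n$, the algebra in (i) is $n$-periodic if and only if $|\alpha|=n$.
   Context: Relations: $R\circ S=\{(x,y)\mid\exists z\,((x,z)\in R,(z,y)\in S)\}$, $R^{\smile}$ the converse; functions are identified with their graphs $\{(x,\gamma(x))\}$; $\gamma^0=\mathrm{id}_X$, $\gamma^{n+1}=\gamma^n\circ\gamma$; $|\gamma|$ is the smallest positive integer $n$ with $\gamma^n=\mathrm{id}_X$. Order automorphism: bijection with $x\le y\iff\alpha(x)\le\alpha(y)$. $E$ is ordered by $(u,v)\preceq(x,y)$ iff $x\le u$ and $v\le y$; $\mathsf{Up}(\mathbf E)$ is the set of up-sets of $\mathbf E=(E,\preceq)$; $R^{c}=E\setminus R$. An FL-algebra is $\langle A,\wedge,\vee,\cdot,1,\backslash,/,0\rangle$ where $\langle A,\wedge,\vee\rangle$ is a lattice, $\langle A,\cdot,1\rangle$ a monoid, $a\cdot b\le c\iff a\le c/b\iff b\le a\backslash c$, and $0\in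 A$ arbitrary; ${\sim}a=a\backslash 0$, ${ - }a=0/a$. It is involutive if ${\sim}{ - }a={ - }{\sim}a=a$ for all $a$, distributive if the lattice is distributive. With ${\sim}^n$, ${ - }^n$ denoting $n$-fold application, an involutive FL-algebra is $n$-periodic if $n$ is the smallest positive integer with ${\sim}^n a={ - }^n a$ for all $a$. -}

module Defs where

open import Data.Nat using (ℕ; zero; suc; _<_)
open import Data.Product using (∃; _×_; _,_)
open import Data.Sum using (_⊎_)
open import Relation.Nullary using (¬_)
open import Relation.Binary.PropositionalEquality using (_≡_)
open import Function.Definitions using (Bijective)
open import Function.Bundles using (_⇔_)

Rel₀ : Set → Set₁
Rel₀ X = X → X → Set

_^[_] : ∀ {A : Set₁} → (A → A) → ℕ → A → A
(f ^[ zero ]) a = a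
(f ^[ suc n ]) a = (f ^[ n ]) (f a)

iterFun : ∀ {X : Set} → (X → X) → ℕ → X → X
iterFun γ zero x = x
iterFun γ (suc n) x = iterFun γ n (γ x)

module _ {X : Set} where

  _⊆ʳ_ : Rel₀ X → Rel₀ X → Set
  R ⊆ʳ S = ∀ x y → R x y → S x y

  _≐_ : Rel₀ X → Rel₀ X → Set
  R ≐ S = (R ⊆ʳ S) × (S ⊆ʳ R)

  _⨾_ : Rel₀ X → Rel₀ X → Rel₀ X
  (R ⨾ S) x y = ∃ λ z → R x z × S z y

  _˘ : Rel₀ X → Rel₀ X
  (R ˘) x y = R y x

  graph : (X → X) → Rel₀ X
  graph f x y = f x ≡ y

  _∩ʳ_ : Rel₀ X → Rel₀ X → Rel₀ X
  (R ∩ʳ S) x y = R x y × S x y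

  _∪ʳ_ : Rel₀ X → Rel₀ X → Rel₀ X
  (R ∪ʳ S) x y = R x y ⊎ S x y

  -- complement relative to E:  R^c = E ∖ R
  compl : Rel₀ X → Rel₀ X → Rel₀ X
  compl E R x y = E x y × ¬ R x y

  -- R is an up-set of (E, ⪯), where (u,v) ⪯ (x,y) iff x ≤ u and v ≤ y
  IsUp : Rel₀ X → Rel₀ X → Rel₀ X → Set
  IsUp _≤_ E R =
    (R ⊆ʳ E) ×
    (∀ u v x y → E u v → E x y → x ≤ u → v ≤ y → R u v → R x y)

  resL : Rel₀ X → Rel₀ X → Rel₀ X → Rel₀ X
  resL E R S = compl E ((R ˘) ⨾ compl E S)

  resR : Rel₀ X → Rel₀ X → Rel₀ X → Rel₀ X
  resR E S R = compl E (compl E S ⨾ (R ˘))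

  zeroRel : Rel₀ X → Rel₀ X → (X → X) → Rel₀ X
  zeroRel _≤_ E α = graph α ⨾ (compl E _≤_ ˘)

  IsOrderAutomorphism : Rel₀ X → (X → X) → Set
  IsOrderAutomorphism _≤_ α =
    Bijective _≡_ _≡_ α × (∀ x y → (x ≤ y) ⇔ (α x ≤ α y))

  OrderIs : (X → X) → ℕ → Set
  OrderIs α n =
    (0 < n) × (∀ x → iterFun α n x ≡ x) ×
    (∀ m → 0 < m → m < n → ¬ (∀ x → iterFun α m x ≡ x))

-- An algebra ⟨A|U, ∧, ∨, ·, 1, \, /, 0⟩ whose carrier is the subset U of A,
-- with equality ≈, is a distributive involutive FL-algebra.
module _ {A : Set₁} (U : A → Set) (_≈_ : A → A → Set) (_∧_ _∨_ _·_ : A → A → A)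
         (e : A) (_\\_ _//_ : A → A → A) (o : A) where

  _≼_ : A → A → Set
  a ≼ b = (a ∧ b) ≈ a

  ∼_ : A → A
  ∼ a = a \\ o

  -_ : A → A
  - a = o // a

  record IsDistInvFLAlgebraOn : Set₁ where
    field
      U-∧ : ∀ {a b} → U a → U b → U (a ∧ b)
      U-∨ : ∀ {a b} → U a → U b → U (a ∨ b)
      U-· : ∀ {a b} → U a → U b → U (a · b)
      U-\\ : ∀ {a b} → U a → U b → U (a \\ b)
      U-// : ∀ {a b} → U a → U b → U (a // b)
      U-e : U e
      U-o : U o
      ≈-refl : ∀ {a} → U a → a ≈ a
      ≈-sym : ∀ {a b} → U a → U b → a ≈ b → b ≈ a
      ≈-trans : ∀ {a b c} → U a → U b → U c → a ≈ b → b ≈ c → a ≈ c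
      ∧-cong : ∀ {a b c d} → U a → U b → U c → U d → a ≈ b → c ≈ d → (a ∧ c) ≈ (b ∧ d)
      ∨-cong : ∀ {a b c d} → U a → U b → U c → U d → a ≈ b → c ≈ d → (a ∨ c) ≈ (b ∨ d)
      ·-cong : ∀ {a b c d} → U a → U b → U c → U d → a ≈ b → c ≈ d → (a · c) ≈ (b · d)
      \\-cong : ∀ {a b c d} → U a → U b → U c → U d → a ≈ b → c ≈ d → (a \\ c) ≈ (b \\ d)
      //-cong : ∀ {a b c d} → U a → U b → U c → U d → a ≈ b → c ≈ d → (a // c) ≈ (b // d)
      ∧-comm : ∀ {a b} → U a → U b → (a ∧ b) ≈ (b ∧ a)
      ∨-comm : ∀ {a b} → U a → U b → (a ∨ b) ≈ (b ∨ a)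
      ∧-assoc : ∀ {a b c} → U a → U b → U c → ((a ∧ b) ∧ c) ≈ (a ∧ (b ∧ c))
      ∨-assoc : ∀ {a b c} → U a → U b → U c → ((a ∨ b) ∨ c) ≈ (a ∨ (b ∨ c))
      ∧-absorbs-∨ : ∀ {a b} → U a → U b → (a ∧ (a ∨ b)) ≈ a
      ∨-absorbs-∧ : ∀ {a b} → U a → U b → (a ∨ (a ∧ b)) ≈ a
      ∧-distrib-∨ : ∀ {a b c} → U a → U b → U c → (a ∧ (b ∨ c)) ≈ ((a ∧ b) ∨ (a ∧ c))
      ·-assoc : ∀ {a b c} → U a → U b → U c → ((a · b) · c) ≈ (a · (b · c))
      ·-identityˡ : ∀ {a} → U a → (e · a) ≈ a
      ·-identityʳ : ∀ {a} → U a → (a · e) ≈ a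
      res-/⇒ : ∀ {a b c} → U a → U b → U c → (a · b) ≼ c → a ≼ (c // b)
      res-/⇐ : ∀ {a b c} → U a → U b → U c → a ≼ (c // b) → (a · b) ≼ c
      res-\\⇒ : ∀ {a b c} → U a → U b → U c → (a · b) ≼ c → b ≼ (a \\ c)
      res-\\⇐ : ∀ {a b c} → U a → U b → U c → b ≼ (a \\ c) → (a · b) ≼ c
      ∼-neg : ∀ {a} → U a → (∼ (- a)) ≈ a
      neg-∼ : ∀ {a} → U a → (- (∼ a)) ≈ a

  SatPer : ℕ → Set₁
  SatPer n = ∀ a → U a → ((∼_) ^[ n ]) a ≈ ((-_) ^[ n ]) a

  IsPeriodic : ℕ → Set₁
  IsPeriodic n = (0 < n) × SatPer n × (∀ m → 0 < m → m < n → ¬ SatPer m)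

module Submission where

open import Defs hiding (∼_)
open import Level using (0ℓ) renaming (suc to lsuc)
open import Axiom.ExcludedMiddle using (ExcludedMiddle)
open import Axiom.DoubleNegationElimination using (DoubleNegationElimination; em⇒dne)
open import Data.Nat using (ℕ; zero; suc; _<_)
open import Data.Product using (_×_; _,_; proj₁; proj₂)
open import Data.Sum using (inj₁; inj₂)
open import Function.Base using (_on_)
open import Function.Bundles using (_⇔_; mk⇔; mk⤖; Equivalence; Inverse)
open import Function.Properties.Bijection using (⤖⇒↔)
open import Function.Properties.Equivalence using () renaming (trans to ⇔-trans)
open import Relation.Nullary using (¬_)
open import Relation.Binary.Bundles using (Setoid)
open import Relation.Binary.Definitions using (Antisymmetric)
open import Relation.Binary.PropositionalEquality using (_≡_; refl; sym; subst; subst₂)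
open import Relation.Binary.Structures using (IsPartialOrder; IsPreorder; IsEquivalence)

-- Classically, the residuals on up-sets are pointwise: for (x, y) ∈ E,
-- (∼R) x y ⇔ ¬ R (α⁻¹ y) x and (−R) x y ⇔ ¬ R y (α x).  So ∼ and − are mutually
-- inverse, −R = (∼R) on α, and − commutes with _on α; hence −ⁿR = (∼ⁿR) on αⁿ.
-- As ∼ⁿ is onto Up(E), n-periodicity says that _on αⁿ fixes every up-set, and
-- testing this on the principal up-set of (p, p) gives αⁿ p = p.

^[]-comm : ∀ {A : Set₁} (f : A → A) n a → (f ^[ n ]) (f a) ≡ f ((f ^[ n ]) a)
^[]-comm f zero    a = refl
^[]-comm f (suc n) a = ^[]-comm f n (f a)

^[]-preserves : ∀ {A : Set₁} {P : A → Set} {f : A → A} →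
                (∀ {a} → P a → P (f a)) → ∀ n {a} → P a → P ((f ^[ n ]) a)
^[]-preserves Pf zero    Pa = Pa
^[]-preserves {P = P} Pf (suc n) Pa = ^[]-preserves {P = P} Pf n (Pf Pa)

^[]-cong : ∀ {A : Set₁} {_≈_ : A → A → Set} {f : A → A} →
           (∀ {a b} → a ≈ b → f a ≈ f b) → ∀ n {a b} → a ≈ b → (f ^[ n ]) a ≈ (f ^[ n ]) b
^[]-cong f-cong zero    a≈b = a≈b
^[]-cong {_≈_ = _≈_} {f} f-cong (suc n) a≈b = ^[]-cong {_≈_ = _≈_} f-cong n (f-cong a≈b)

module Relations {X : Set} where

  ⊆-refl : {R : Rel₀ X} → R ⊆ʳ R
  ⊆-refl _ _ r = r

  ≐-isEquivalence : IsEquivalence (_≐_ {X})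
  ≐-isEquivalence = record
    { refl  = ⊆-refl , ⊆-refl
    ; sym   = λ (p , q) → q , p
    ; trans = λ (p , q) (p′ , q′) → (λ x y r → p′ x y (p x y r)) , (λ x y r → q x y (q′ x y r))
    }

  ≐-setoid : Setoid (lsuc 0ℓ) 0ℓ
  ≐-setoid = record { isEquivalence = ≐-isEquivalence }

  open IsEquivalence ≐-isEquivalence public
    using () renaming (refl to ≐-refl; sym to ≐-sym; trans to ≐-trans)

  ⊆⇒≼ : {R S : Rel₀ X} → R ⊆ʳ S → (R ∩ʳ S) ≐ R
  ⊆⇒≼ R⊆S = (λ _ _ → proj₁) , (λ x y r → r , R⊆S x y r)

  ≼⇒⊆ : {R S : Rel₀ X} → (R ∩ʳ S) ≐ R → R ⊆ʳ S
  ≼⇒⊆ (_ , R⊆R∩S) x y r = proj₂ (R⊆R∩S x y r)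

  ∩ʳ-cong : {R R′ S S′ : Rel₀ X} → R ≐ R′ → S ≐ S′ → (R ∩ʳ S) ≐ (R′ ∩ʳ S′)
  ∩ʳ-cong (p , q) (p′ , q′) =
    (λ x y (r , s) → p x y r , p′ x y s) , (λ x y (r , s) → q x y r , q′ x y s)

  ∪ʳ-cong : {R R′ S S′ : Rel₀ X} → R ≐ R′ → S ≐ S′ → (R ∪ʳ S) ≐ (R′ ∪ʳ S′)
  ∪ʳ-cong (p , q) (p′ , q′) =
    (λ { x y (inj₁ r) → inj₁ (p x y r) ; x y (inj₂ s) → inj₂ (p′ x y s) }) ,
    (λ { x y (inj₁ r) → inj₁ (q x y r) ; x y (inj₂ s) → inj₂ (q′ x y s) })

  ⨾-cong : {R R′ S S′ : Rel₀ X} → R ≐ R′ → S ≐ S′ → (R ⨾ S) ≐ (R′ ⨾ S′)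
  ⨾-cong (p , q) (p′ , q′) =
    (λ x y (z , r , s) → z , p x z r , p′ z y s) , (λ x y (z , r , s) → z , q x z r , q′ z y s)

  on-cong : {R S : Rel₀ X} (f : X → X) → R ≐ S → (R on f) ≐ (S on f)
  on-cong f (p , q) = (λ x y → p (f x) (f y)) , (λ x y → q (f x) (f y))

  ∩ʳ-comm : {R S : Rel₀ X} → (R ∩ʳ S) ≐ (S ∩ʳ R)
  ∩ʳ-comm = (λ x y (r , s) → s , r) , (λ x y (s , r) → r , s)

  ∪ʳ-comm : {R S : Rel₀ X} → (R ∪ʳ S) ≐ (S ∪ʳ R)
  ∪ʳ-comm = swap , swap
    where
    swap : ∀ {R S : Rel₀ X} → (R ∪ʳ S) ⊆ʳ (S ∪ʳ R)
    swap _ _ (inj₁ r) = inj₂ r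
    swap _ _ (inj₂ s) = inj₁ s

  ∩ʳ-assoc : {R S T : Rel₀ X} → ((R ∩ʳ S) ∩ʳ T) ≐ (R ∩ʳ (S ∩ʳ T))
  ∩ʳ-assoc = (λ x y ((r , s) , t) → r , s , t) , (λ x y (r , s , t) → (r , s) , t)

  ∪ʳ-assoc : {R S T : Rel₀ X} → ((R ∪ʳ S) ∪ʳ T) ≐ (R ∪ʳ (S ∪ʳ T))
  ∪ʳ-assoc =
    (λ { x y (inj₁ (inj₁ r)) → inj₁ r
       ; x y (inj₁ (inj₂ s)) → inj₂ (inj₁ s)
       ; x y (inj₂ t)        → inj₂ (inj₂ t) }) ,
    (λ { x y (inj₁ r)        → inj₁ (inj₁ r)
       ; x y (inj₂ (inj₁ s)) → inj₁ (inj₂ s)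
       ; x y (inj₂ (inj₂ t)) → inj₂ t })

  ∩ʳ-absorbs-∪ʳ : {R S : Rel₀ X} → (R ∩ʳ (R ∪ʳ S)) ≐ R
  ∩ʳ-absorbs-∪ʳ = (λ _ _ → proj₁) , (λ x y r → r , inj₁ r)

  ∪ʳ-absorbs-∩ʳ : {R S : Rel₀ X} → (R ∪ʳ (R ∩ʳ S)) ≐ R
  ∪ʳ-absorbs-∩ʳ = (λ { x y (inj₁ r) → r ; x y (inj₂ (r , _)) → r }) , (λ x y → inj₁)

  ∩ʳ-distribˡ-∪ʳ : {R S T : Rel₀ X} → (R ∩ʳ (S ∪ʳ T)) ≐ ((R ∩ʳ S) ∪ʳ (R ∩ʳ T))
  ∩ʳ-distribˡ-∪ʳ =
    (λ { x y (r , inj₁ s) → inj₁ (r , s) ; x y (r , inj₂ t) → inj₂ (r , t) }) ,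
    (λ { x y (inj₁ (r , s)) → r , inj₁ s ; x y (inj₂ (r , t)) → r , inj₂ t })

  ⨾-assoc : {R S T : Rel₀ X} → ((R ⨾ S) ⨾ T) ≐ (R ⨾ (S ⨾ T))
  ⨾-assoc = (λ x y (w , (z , r , s) , t) → z , r , w , s , t) ,
            (λ x y (z , r , w , s , t) → w , (z , r , s) , t)

  resL-mono : {E R R′ S S′ : Rel₀ X} → R′ ⊆ʳ R → S ⊆ʳ S′ → resL E R S ⊆ʳ resL E R′ S′
  resL-mono R′⊆R S⊆S′ x y (e , ∄) =
    e , λ (z , r , e′ , ¬s) → ∄ (z , R′⊆R z x r , e′ , λ s → ¬s (S⊆S′ z y s))

  resR-mono : {E S S′ R R′ : Rel₀ X} → S ⊆ʳ S′ → R′ ⊆ʳ R → resR E S R ⊆ʳ resR E S′ R′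
  resR-mono S⊆S′ R′⊆R x y (e , ∄) =
    e , λ (z , (e′ , ¬s) , r) → ∄ (z , (e′ , λ s → ¬s (S⊆S′ x z s)) , R′⊆R y z r)

  resL-cong : {E R R′ S S′ : Rel₀ X} → R ≐ R′ → S ≐ S′ → resL E R S ≐ resL E R′ S′
  resL-cong (p , q) (p′ , q′) = resL-mono q p′ , resL-mono p q′

  resR-cong : {E S S′ R R′ : Rel₀ X} → S ≐ S′ → R ≐ R′ → resR E S R ≐ resR E S′ R′
  resR-cong (p , q) (p′ , q′) = resR-mono p q′ , resR-mono q p′

open Relations

module UpSets (dne : DoubleNegationElimination 0ℓ)
              {X : Set} {_≤_ : Rel₀ X} (≤-isPreorder : IsPreorder _≡_ _≤_)
              {E : Rel₀ X} (E-isEquivalence : IsEquivalence E) (≤⊆E : _≤_ ⊆ʳ E) where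

  module ≤ = IsPreorder ≤-isPreorder
  module E = IsEquivalence E-isEquivalence

  Up : Rel₀ X → Set
  Up = IsUp _≤_ E

  private
    variable
      x y u v : X
      R S T : Rel₀ X

  E-between : x ≤ u → E u v → v ≤ y → E x y
  E-between x≤u e v≤y = E.trans (≤⊆E _ _ x≤u) (E.trans e (≤⊆E _ _ v≤y))

  Up⇒⊆E : Up R → R ⊆ʳ E
  Up⇒⊆E = proj₁

  mkUp : R ⊆ʳ E → (∀ {u v x y} → x ≤ u → v ≤ y → R u v → R x y) → Up R
  mkUp R⊆E closed = R⊆E , λ _ _ _ _ _ _ → closed

  up-closed : Up R → x ≤ u → v ≤ y → R u v → R x y
  up-closed (R⊆E , closed) x≤u v≤y r =
    closed _ _ _ _ (R⊆E _ _ r) (E-between x≤u (R⊆E _ _ r) v≤y) x≤u v≤y r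

  Up-≤ : Up _≤_
  Up-≤ = mkUp ≤⊆E λ x≤u v≤y u≤v → ≤.trans x≤u (≤.trans u≤v v≤y)

  Up-∩ʳ : Up R → Up S → Up (R ∩ʳ S)
  Up-∩ʳ uR uS = mkUp (λ x y (r , _) → Up⇒⊆E uR x y r)
    λ x≤u v≤y (r , s) → up-closed uR x≤u v≤y r , up-closed uS x≤u v≤y s

  Up-∪ʳ : Up R → Up S → Up (R ∪ʳ S)
  Up-∪ʳ uR uS = mkUp
    (λ { x y (inj₁ r) → Up⇒⊆E uR x y r ; x y (inj₂ s) → Up⇒⊆E uS x y s })
    (λ { x≤u v≤y (inj₁ r) → inj₁ (up-closed uR x≤u v≤y r)
       ; x≤u v≤y (inj₂ s) → inj₂ (up-closed uS x≤u v≤y s) })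

  Up-⨾ : Up R → Up S → Up (R ⨾ S)
  Up-⨾ uR uS = mkUp (λ x y (z , r , s) → E.trans (Up⇒⊆E uR x z r) (Up⇒⊆E uS z y s))
    λ x≤u v≤y (z , r , s) → z , up-closed uR x≤u ≤.refl r , up-closed uS ≤.refl v≤y s

  ≤-⨾-identityˡ : Up R → (_≤_ ⨾ R) ≐ R
  ≤-⨾-identityˡ uR = (λ x y (z , x≤z , r) → up-closed uR x≤z ≤.refl r) ,
                     (λ x y r → x , ≤.refl , r)

  ≤-⨾-identityʳ : Up R → (R ⨾ _≤_) ≐ R
  ≤-⨾-identityʳ uR = (λ x y (z , r , z≤y) → up-closed uR ≤.refl z≤y r) ,
                     (λ x y r → y , r , ≤.refl)

  resL-intro : E x y → (∀ {z} → R z x → S z y) → resL E R S x y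
  resL-intro e h = e , λ (z , r , _ , ¬s) → ¬s (h r)

  resL-elim : Up R → resL E R S x y → ∀ {z} → R z x → S z y
  resL-elim uR (e , ∄) r = dne λ ¬s → ∄ (_ , r , E.trans (Up⇒⊆E uR _ _ r) e , ¬s)

  resR-intro : E x y → (∀ {z} → R y z → S x z) → resR E S R x y
  resR-intro e h = e , λ (z , (_ , ¬s) , r) → ¬s (h r)

  resR-elim : Up R → resR E S R x y → ∀ {z} → R y z → S x z
  resR-elim uR (e , ∄) r = dne λ ¬s → ∄ (_ , (E.trans e (Up⇒⊆E uR _ _ r) , ¬s) , r)

  Up-resL : Up R → Up S → Up (resL E R S)
  Up-resL {R} {S} uR uS = mkUp (λ _ _ → proj₁) λ x≤u v≤y p →
    resL-intro {R = R} {S = S} (E-between x≤u (proj₁ p) v≤y)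
      λ r → up-closed uS ≤.refl v≤y (resL-elim {S = S} uR p (up-closed uR ≤.refl x≤u r))

  Up-resR : Up S → Up R → Up (resR E S R)
  Up-resR {S} {R} uS uR = mkUp (λ _ _ → proj₁) λ x≤u v≤y p →
    resR-intro {R = R} {S = S} (E-between x≤u (proj₁ p) v≤y)
      λ r → up-closed uS x≤u ≤.refl (resR-elim {S = S} uR p (up-closed uR v≤y ≤.refl r))

  ⨾⊆⇒⊆resR : Up R → (R ⨾ S) ⊆ʳ T → R ⊆ʳ resR E T S
  ⨾⊆⇒⊆resR {S = S} {T = T} uR RS⊆T x y r =
    resR-intro {R = S} {S = T} (Up⇒⊆E uR x y r) λ s → RS⊆T _ _ (y , r , s)

  ⊆resR⇒⨾⊆ : Up S → R ⊆ʳ resR E T S → (R ⨾ S) ⊆ʳ T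
  ⊆resR⇒⨾⊆ {T = T} uS R⊆T/S x y (z , r , s) = resR-elim {S = T} uS (R⊆T/S x z r) s

  ⨾⊆⇒⊆resL : Up S → (R ⨾ S) ⊆ʳ T → S ⊆ʳ resL E R T
  ⨾⊆⇒⊆resL {R = R} {T = T} uS RS⊆T x y s =
    resL-intro {R = R} {S = T} (Up⇒⊆E uS x y s) λ r → RS⊆T _ _ (x , r , s)

  ⊆resL⇒⨾⊆ : Up R → S ⊆ʳ resL E R T → (R ⨾ S) ⊆ʳ T
  ⊆resL⇒⨾⊆ {T = T} uR S⊆R\T x y (z , r , s) = resL-elim {S = T} uR (S⊆R\T z y s) r

  principal : X → Rel₀ X
  principal p x y = E x y × x ≤ p × p ≤ y

  Up-principal : ∀ p → Up (principal p)
  Up-principal p = mkUp (λ _ _ → proj₁)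
    λ x≤u v≤y (e , u≤p , p≤v) → E-between x≤u e v≤y , ≤.trans x≤u u≤p , ≤.trans p≤v v≤y

  fixes-Up⇔≗id : Antisymmetric _≡_ _≤_ → (f : X → X) →
                 (∀ T → Up T → T ≐ (T on f)) ⇔ (∀ x → f x ≡ x)
  fixes-Up⇔≗id antisym f = mk⇔ fixed⇒≗id ≗id⇒fixed
    where
    fixed⇒≗id : (∀ T → Up T → T ≐ (T on f)) → ∀ x → f x ≡ x
    fixed⇒≗id fixes p with proj₁ (fixes (principal p) (Up-principal p)) p p (E.refl , ≤.refl , ≤.refl)
    ... | _ , fp≤p , p≤fp = antisym fp≤p p≤fp

    ≗id⇒fixed : (∀ x → f x ≡ x) → ∀ T → Up T → T ≐ (T on f)
    ≗id⇒fixed f≗id T _ = (λ x y → subst₂ T (sym (f≗id x)) (sym (f≗id y))) ,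
                         (λ x y → subst₂ T (f≗id x) (f≗id y))

module UpSetAlgebra (dne : DoubleNegationElimination 0ℓ)
                {X : Set} {_≤_ : Rel₀ X} (≤-isPartialOrder : IsPartialOrder _≡_ _≤_)
                {E : Rel₀ X} (E-isEquivalence : IsEquivalence E) (≤⊆E : _≤_ ⊆ʳ E)
                {α : X → X} (α-aut : IsOrderAutomorphism _≤_ α) (α⊆E : graph α ⊆ʳ E) where

  open IsPartialOrder ≤-isPartialOrder using (isPreorder; antisym)
  open UpSets dne isPreorder E-isEquivalence ≤⊆E
  open Inverse (⤖⇒↔ (mk⤖ (proj₁ α-aut)))
    using () renaming (from to β; strictlyInverseˡ to α∘β; strictlyInverseʳ to β∘α)

  private
    variable
      x y : X
      R T : Rel₀ X

  α-mono : x ≤ y → α x ≤ α y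
  α-mono = Equivalence.to (proj₂ α-aut _ _)

  α-reflects : α x ≤ α y → x ≤ y
  α-reflects = Equivalence.from (proj₂ α-aut _ _)

  β-adjoint : y ≤ α x → β y ≤ x
  β-adjoint {y} {x} y≤αx = α-reflects (subst₂ _≤_ (sym (α∘β y)) refl y≤αx)

  E-α : ∀ x → E x (α x)
  E-α x = α⊆E x (α x) refl

  E-β : ∀ x → E (β x) x
  E-β x = subst (E (β x)) (α∘β x) (E-α (β x))

  E-on-α : E x y → E (α x) (α y)
  E-on-α e = E.trans (E.sym (E-α _)) (E.trans e (E-α _))

  E-on-α⁻¹ : E (α x) (α y) → E x y
  E-on-α⁻¹ e = E.trans (E-α _) (E.trans e (E.sym (E-α _)))

  0ᴿ : Rel₀ X
  0ᴿ = zeroRel _≤_ E α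

  0ᴿ-intro : E x y → ¬ y ≤ α x → 0ᴿ x y
  0ᴿ-intro e y≰αx = _ , refl , E.trans (E.sym e) (E-α _) , y≰αx

  0ᴿ-elim : 0ᴿ x y → ¬ y ≤ α x
  0ᴿ-elim (_ , refl , _ , y≰αx) = y≰αx

  0ᴿ⊆E : 0ᴿ ⊆ʳ E
  0ᴿ⊆E x y (_ , refl , e , _) = E.trans (E-α x) (E.sym e)

  Up-0ᴿ : Up 0ᴿ
  Up-0ᴿ = mkUp 0ᴿ⊆E λ x≤u v≤y o →
    0ᴿ-intro (E-between x≤u (0ᴿ⊆E _ _ o) v≤y)
      λ y≤αx → 0ᴿ-elim o (≤.trans v≤y (≤.trans y≤αx (α-mono x≤u)))

  0ᴿ≐≰˘⨾α : 0ᴿ ≐ ((compl E _≤_ ˘) ⨾ graph α)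
  0ᴿ≐≰˘⨾α = ⊆ , ⊇
    where
    ⊆ : 0ᴿ ⊆ʳ ((compl E _≤_ ˘) ⨾ graph α)
    ⊆ x y o = β y , (E.trans (E-β y) (E.sym (0ᴿ⊆E x y o)) ,
                     λ βy≤x → 0ᴿ-elim o (subst (_≤ α x) (α∘β y) (α-mono βy≤x))) , α∘β y

    ⊇ : ((compl E _≤_ ˘) ⨾ graph α) ⊆ʳ 0ᴿ
    ⊇ x _ (z , (e , z≰x) , refl) =
      0ᴿ-intro (E.trans (E.sym e) (E-α z)) λ αz≤αx → z≰x (α-reflects αz≤αx)

  infix 25 ∼_ −_

  ∼_ : Rel₀ X → Rel₀ X
  ∼ R = resL E R 0ᴿ

  −_ : Rel₀ X → Rel₀ X
  − R = resR E 0ᴿ R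

  Up-∼ : Up R → Up (∼ R)
  Up-∼ uR = Up-resL uR Up-0ᴿ

  Up-− : Up R → Up (− R)
  Up-− uR = Up-resR Up-0ᴿ uR

  ∼-intro : Up R → E x y → ¬ R (β y) x → (∼ R) x y
  ∼-intro {R = R} uR e ¬r = resL-intro {R = R} {S = 0ᴿ} e λ r →
    0ᴿ-intro (E.trans (Up⇒⊆E uR _ _ r) e) λ y≤αz → ¬r (up-closed uR (β-adjoint y≤αz) ≤.refl r)

  ∼-elim : Up R → (∼ R) x y → ¬ R (β y) x
  ∼-elim {y = y} uR p r = 0ᴿ-elim (resL-elim {S = 0ᴿ} uR p r) (≤.reflexive (sym (α∘β y)))

  −-intro : Up R → E x y → ¬ R y (α x) → (− R) x y
  −-intro {R = R} uR e ¬r = resR-intro {R = R} {S = 0ᴿ} e λ r →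
    0ᴿ-intro (E.trans e (Up⇒⊆E uR _ _ r)) λ z≤αx → ¬r (up-closed uR ≤.refl z≤αx r)

  −-elim : Up R → (− R) x y → ¬ R y (α x)
  −-elim uR p r = 0ᴿ-elim (resR-elim {S = 0ᴿ} uR p r) ≤.refl

  ∼-cong : {R S : Rel₀ X} → R ≐ S → (∼ R) ≐ (∼ S)
  ∼-cong R≐S = resL-cong R≐S ≐-refl

  −-cong : {R S : Rel₀ X} → R ≐ S → (− R) ≐ (− S)
  −-cong R≐S = resR-cong ≐-refl R≐S

  ∼−≐id : Up R → ∼ (− R) ≐ R
  ∼−≐id {R} uR = ⊆ , ⊇
    where
    ⊆ : ∼ (− R) ⊆ʳ R
    ⊆ x y p = dne λ ¬r → ∼-elim (Up-− uR) p
      (−-intro uR (E.trans (E-β y) (E.sym (proj₁ p))) λ r → ¬r (subst (R x) (α∘β y) r))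

    ⊇ : R ⊆ʳ ∼ (− R)
    ⊇ x y r = ∼-intro (Up-− uR) (Up⇒⊆E uR x y r)
      λ q → −-elim uR q (subst (R x) (sym (α∘β y)) r)

  −∼≐id : Up R → − (∼ R) ≐ R
  −∼≐id {R} uR = ⊆ , ⊇
    where
    ⊆ : − (∼ R) ⊆ʳ R
    ⊆ x y p = dne λ ¬r → −-elim (Up-∼ uR) p
      (∼-intro uR (E.trans (E.sym (proj₁ p)) (E-α x))
        λ r → ¬r (subst (λ t → R t y) (β∘α x) r))

    ⊇ : R ⊆ʳ − (∼ R)
    ⊇ x y r = −-intro (Up-∼ uR) (Up⇒⊆E uR x y r)
      λ q → ∼-elim uR q (subst (λ t → R t y) (sym (β∘α x)) r)

  isDistInvFLAlgebra : IsDistInvFLAlgebraOn Up _≐_ _∩ʳ_ _∪ʳ_ _⨾_ _≤_ (resL E) (resR E) 0ᴿ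
  isDistInvFLAlgebra = record
    { U-∧ = Up-∩ʳ
    ; U-∨ = Up-∪ʳ
    ; U-· = Up-⨾
    ; U-\\ = Up-resL
    ; U-// = Up-resR
    ; U-e = Up-≤
    ; U-o = Up-0ᴿ
    ; ≈-refl = λ _ → ≐-refl
    ; ≈-sym = λ _ _ → ≐-sym
    ; ≈-trans = λ _ _ _ → ≐-trans
    ; ∧-cong = λ _ _ _ _ → ∩ʳ-cong
    ; ∨-cong = λ _ _ _ _ → ∪ʳ-cong
    ; ·-cong = λ _ _ _ _ → ⨾-cong
    ; \\-cong = λ _ _ _ _ → resL-cong
    ; //-cong = λ _ _ _ _ → resR-cong
    ; ∧-comm = λ _ _ → ∩ʳ-comm
    ; ∨-comm = λ _ _ → ∪ʳ-comm
    ; ∧-assoc = λ _ _ _ → ∩ʳ-assoc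
    ; ∨-assoc = λ _ _ _ → ∪ʳ-assoc
    ; ∧-absorbs-∨ = λ _ _ → ∩ʳ-absorbs-∪ʳ
    ; ∨-absorbs-∧ = λ _ _ → ∪ʳ-absorbs-∩ʳ
    ; ∧-distrib-∨ = λ _ _ _ → ∩ʳ-distribˡ-∪ʳ
    ; ·-assoc = λ _ _ _ → ⨾-assoc
    ; ·-identityˡ = ≤-⨾-identityˡ
    ; ·-identityʳ = ≤-⨾-identityʳ
    ; res-/⇒ = λ uR uS _ h → ⊆⇒≼ (⨾⊆⇒⊆resR uR (≼⇒⊆ h))
    ; res-/⇐ = λ _ uS _ h → ⊆⇒≼ (⊆resR⇒⨾⊆ uS (≼⇒⊆ h))
    ; res-\\⇒ = λ _ uS _ h → ⊆⇒≼ (⨾⊆⇒⊆resL uS (≼⇒⊆ h))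
    ; res-\\⇐ = λ uR _ _ h → ⊆⇒≼ (⊆resL⇒⨾⊆ uR (≼⇒⊆ h))
    ; ∼-neg = ∼−≐id
    ; neg-∼ = −∼≐id
    }

  Up-on-α : Up T → Up (T on α)
  Up-on-α uT = mkUp (λ x y t → E-on-α⁻¹ (Up⇒⊆E uT _ _ t))
    λ x≤u v≤y t → up-closed uT (α-mono x≤u) (α-mono v≤y) t

  −≐∼-on-α : Up R → − R ≐ ((∼ R) on α)
  −≐∼-on-α {R} uR =
    (λ x y p → ∼-intro uR (E-on-α (proj₁ p))
                 λ r → −-elim uR p (subst (λ t → R t (α x)) (β∘α y) r)) ,
    (λ x y q → −-intro uR (E-on-α⁻¹ (proj₁ q))
                 λ r → ∼-elim uR q (subst (λ t → R t (α x)) (sym (β∘α y)) r))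

  −-on-α : Up T → − (T on α) ≐ ((− T) on α)
  −-on-α uT = (λ x y p → −-intro uT (E-on-α (proj₁ p)) (−-elim (Up-on-α uT) p)) ,
              (λ x y q → −-intro (Up-on-α uT) (E-on-α⁻¹ (proj₁ q)) (−-elim uT q))

  Up-∼ⁿ : ∀ n {R} → Up R → Up ((∼_ ^[ n ]) R)
  Up-∼ⁿ = ^[]-preserves Up-∼

  Up-−ⁿ : ∀ n {R} → Up R → Up ((−_ ^[ n ]) R)
  Up-−ⁿ = ^[]-preserves Up-−

  ∼ⁿ-cong : ∀ n {R S} → R ≐ S → (∼_ ^[ n ]) R ≐ (∼_ ^[ n ]) S
  ∼ⁿ-cong = ^[]-cong ∼-cong

  −ⁿ-cong : ∀ n {R S} → R ≐ S → (−_ ^[ n ]) R ≐ (−_ ^[ n ]) S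
  −ⁿ-cong = ^[]-cong −-cong

  −ⁿ-on-α : ∀ n {T} → Up T → (−_ ^[ n ]) (T on α) ≐ (((−_ ^[ n ]) T) on α)
  −ⁿ-on-α zero    uT = ≐-refl
  −ⁿ-on-α (suc n) uT = ≐-trans (−ⁿ-cong n (−-on-α uT)) (−ⁿ-on-α n (Up-− uT))

  −ⁿ≐∼ⁿ-on-αⁿ : ∀ n {R} → Up R → (−_ ^[ n ]) R ≐ (((∼_ ^[ n ]) R) on iterFun α n)
  −ⁿ≐∼ⁿ-on-αⁿ zero    uR = ≐-refl
  −ⁿ≐∼ⁿ-on-αⁿ (suc n) {R} uR = begin
    (−_ ^[ n ]) (− R)                                     ≈⟨ −ⁿ-cong n (−≐∼-on-α uR) ⟩
    (−_ ^[ n ]) ((∼ R) on α)                              ≈⟨ −ⁿ-on-α n (Up-∼ uR) ⟩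
    (((−_ ^[ n ]) (∼ R)) on α)                            ≈⟨ on-cong α (−ⁿ≐∼ⁿ-on-αⁿ n (Up-∼ uR)) ⟩
    ((((∼_ ^[ n ]) (∼ R)) on iterFun α n) on α)           ∎
    where open import Relation.Binary.Reasoning.Setoid ≐-setoid

  ∼ⁿ−ⁿ≐id : ∀ n {T} → Up T → (∼_ ^[ n ]) ((−_ ^[ n ]) T) ≐ T
  ∼ⁿ−ⁿ≐id zero    uT = ≐-refl
  ∼ⁿ−ⁿ≐id (suc n) {T} uT rewrite ^[]-comm −_ n T =
    ≐-trans (∼ⁿ-cong n (∼−≐id (Up-−ⁿ n uT))) (∼ⁿ−ⁿ≐id n uT)

  SatPerⁿ : ℕ → Set₁
  SatPerⁿ = SatPer Up _≐_ _∩ʳ_ _∪ʳ_ _⨾_ _≤_ (resL E) (resR E) 0ᴿ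

  satPer⇔αⁿ-fixes-Up : ∀ n → SatPerⁿ n ⇔ (∀ T → Up T → T ≐ (T on iterFun α n))
  satPer⇔αⁿ-fixes-Up n = mk⇔ sat⇒fixes fixes⇒sat
    where
    open import Relation.Binary.Reasoning.Setoid ≐-setoid

    sat⇒fixes : SatPerⁿ n → ∀ T → Up T → T ≐ (T on iterFun α n)
    sat⇒fixes sat T uT = begin
      T                                ≈⟨ ≐-sym (∼ⁿ−ⁿ≐id n uT) ⟩
      (∼_ ^[ n ]) S                    ≈⟨ sat S (Up-−ⁿ n uT) ⟩
      (−_ ^[ n ]) S                    ≈⟨ −ⁿ≐∼ⁿ-on-αⁿ n (Up-−ⁿ n uT) ⟩
      (((∼_ ^[ n ]) S) on iterFun α n) ≈⟨ on-cong (iterFun α n) (∼ⁿ−ⁿ≐id n uT) ⟩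
      (T on iterFun α n)               ∎
      where S = (−_ ^[ n ]) T

    fixes⇒sat : (∀ T → Up T → T ≐ (T on iterFun α n)) → SatPerⁿ n
    fixes⇒sat fixes R uR = ≐-trans (fixes _ (Up-∼ⁿ n uR)) (≐-sym (−ⁿ≐∼ⁿ-on-αⁿ n uR))

  satPer⇔αⁿ≗id : ∀ n → SatPerⁿ n ⇔ (∀ x → iterFun α n x ≡ x)
  satPer⇔αⁿ≗id n = ⇔-trans (satPer⇔αⁿ-fixes-Up n) (fixes-Up⇔≗id antisym (iterFun α n))

  isPeriodic⇔orderIs : ∀ n →
    IsPeriodic Up _≐_ _∩ʳ_ _∪ʳ_ _⨾_ _≤_ (resL E) (resR E) 0ᴿ n ⇔ OrderIs α n
  isPeriodic⇔orderIs n = mk⇔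
    (λ (0<n , sat , minimal) →
       0<n , to n sat , λ m 0<m m<n αᵐ≗id → minimal m 0<m m<n (from m αᵐ≗id))
    (λ (0<n , αⁿ≗id , minimal) →
       0<n , from n αⁿ≗id , λ m 0<m m<n sat → minimal m 0<m m<n (to m sat))
    where
    to : ∀ m → SatPerⁿ m → ∀ x → iterFun α m x ≡ x
    to m = Equivalence.to (satPer⇔αⁿ≗id m)

    from : ∀ m → (∀ x → iterFun α m x ≡ x) → SatPerⁿ m
    from m = Equivalence.from (satPer⇔αⁿ≗id m)

theorem3p12 : ExcludedMiddle 0ℓ →
    (X : Set) (_≤_ : Rel₀ X) → IsPartialOrder _≡_ _≤_ →
    (E : Rel₀ X) → IsEquivalence E → (_≤_ ⊆ʳ E) →
    (α : X → X) → IsOrderAutomorphism _≤_ α → (graph α ⊆ʳ E) →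
    (zeroRel _≤_ E α ≐ ((compl E _≤_ ˘) ⨾ graph α))
    × IsDistInvFLAlgebraOn (IsUp _≤_ E) _≐_ _∩ʳ_ _∪ʳ_ _⨾_ _≤_ (resL E) (resR E) (zeroRel _≤_ E α)
    × (∀ (n : ℕ) → 0 < n →
         IsPeriodic (IsUp _≤_ E) _≐_ _∩ʳ_ _∪ʳ_ _⨾_ _≤_ (resL E) (resR E) (zeroRel _≤_ E α) n
         ⇔ OrderIs α n)
theorem3p12 em X _≤_ ≤-po E E-eq ≤⊆E α α-aut α⊆E =
  0ᴿ≐≰˘⨾α , isDistInvFLAlgebra , λ n _ → isPeriodic⇔orderIs n
  where open UpSetAlgebra (em⇒dne em) ≤-po E-eq ≤⊆E α-aut α⊆E
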